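{- Let $(\dot P,\dot T)$ be a pair of strings, let $\Delta',\Delta,\nabla',\nabla\in\{0,\dots,|\dot T|\}$ with $\Delta'\le\Delta$ and $\nabla'\le\nabla$, and let $k',k\in\mathbb{R}_{\ge0}$ with $k'\le k$. For every $(\Delta\to\nabla,k)$-fern $F$ of $\dot P$ and $\dot T$ with respect to $w$, the contiguous submatrix $F'=F[\{0,\dots,\Delta'\},\{\nabla-\nabla',\dots,\nabla\}]$ is a $(\Delta'\to\nabla',k')$-fern of $\dot P$ and $\dot T$ with respect to $w$. Moreover $\delta(F')\le\delta(F)$, and if $F$ is integer-valued and $\beta$-bounded-difference, then so is $F'$.
   Context: Let $w:\bar\Sigma^2\to[0,W]$ be a normalized weight function ($w(a,a)=0$, $w(a,b)\ge1$ for $a\ne b$, where $\bar\Sigma=\Sigma\cup\{\varepsilon\}$). The augmented alignment graph $\overline{\mathsf{AG}}^w(X,Y)$ has vertex set $\{0,\dots,|X|\}\times\{0,\dots,|Y|\}$, edges $(x,y)\to(x+1,y)$ of cost $w(X[x],\varepsilon)$, $(x,y)\to(x,y+1)$ of cost $w(\varepsilon,Y[y])$, $(x,y)\to(x+1,y+1)$ of cost $w(X[x],Y[y])$, and for each of these edges a reverse edge of cost $W+1$. The $(\Delta\to\nabla)$-restricted distance matrix of $(\dot P,\dot T)$ is the $(\Delta+1)\times(\nabla+1)$ matrix $D$ with $D[i,j]=\mathrm{dist}_{\overline{\mathsf{AG}}^w(\dot P,\dot T)}((0,i),(|\dot P|,|\dot T|-\nabla+j))$. Reals $a,b$ are $k$-equivalent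 if $a=b$ or $k\le\min\{a,b\}$; matrices are $k$-equivalent if entrywise $k$-equivalent. A $(\Delta\to\nabla,k)$-fern of $\dot P,\dot T$ is any matrix $k$-equivalent to the $(\Delta\to\nabla)$-restricted distance matrix. For a $p\times q$ matrix $A$, its density matrix has entries $A[i,j+1]+A[i+1,j]-A[i,j]-A[i+1,j+1]$, and $\delta(A)$ is the number of nonzero entries of the density matrix. An integer matrix is $\beta$-bounded-difference if horizontally and vertically adjacent entries differ by at most $\beta$.
   Formalization: The weight function $w$, the bound $W$, the thresholds $k'$ and $k$, and the entries of every fern are rational rather than real. -}

module Defs where

open import Data.Nat as ℕ using (ℕ; zero; suc; _∸_; s≤s; z≤n)
import Data.Nat.Properties as ℕP
open import Data.Integer using (ℤ; +_)
open import Data.Rational using (ℚ; 0ℚ; 1ℚ; _+_; _-_; _≤_; ∣_∣; _/_)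
open import Data.Rational.Properties using (_≟_)
open import Data.Fin using (Fin; toℕ; fromℕ<; inject₁) renaming (suc to fsuc)
open import Data.Fin.Properties using (toℕ≤pred[n])
open import Data.Vec using (Vec; lookup)
open import Data.Maybe using (Maybe; just; nothing)
open import Data.Product using (Σ; ∃; _×_; _,_; proj₁; proj₂)
open import Data.Sum using (_⊎_)
open import Data.List using (List; length; filter; cartesianProduct; allFin)


open import Relation.Nullary using (¬_; ¬?)
open import Relation.Binary.PropositionalEquality using (_≡_; _≢_)

-- Σ̄ = Σ ∪ {ε} is rendered as Maybe Σ, with ε = nothing.

record Normalized {Σ' : Set} (W : ℚ) (w : Maybe Σ' → Maybe Σ' → ℚ) : Set where
  field
    nonneg   : ∀ a b → 0ℚ ≤ w a b
    bounded  : ∀ a b → w a b ≤ W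
    diag     : ∀ a → w a a ≡ 0ℚ
    offdiag  : ∀ a b → a ≢ b → 1ℚ ≤ w a b

Vertex : Set
Vertex = ℕ × ℕ

data Fwd {Σ' : Set} (w : Maybe Σ' → Maybe Σ' → ℚ) {m n : ℕ}
         (X : Vec Σ' m) (Y : Vec Σ' n) : Vertex → Vertex → ℚ → Set where
  del : (i : Fin m) (y : ℕ) → y ℕ.≤ n →
        Fwd w X Y (toℕ i , y) (suc (toℕ i) , y) (w (just (lookup X i)) nothing)
  ins : (x : ℕ) → x ℕ.≤ m → (j : Fin n) →
        Fwd w X Y (x , toℕ j) (x , suc (toℕ j)) (w nothing (just (lookup Y j)))
  sub : (i : Fin m) (j : Fin n) →
        Fwd w X Y (toℕ i , toℕ j) (suc (toℕ i) , suc (toℕ j))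
                  (w (just (lookup X i)) (just (lookup Y j)))

data Edge {Σ' : Set} (W : ℚ) (w : Maybe Σ' → Maybe Σ' → ℚ) {m n : ℕ}
          (X : Vec Σ' m) (Y : Vec Σ' n) : Vertex → Vertex → ℚ → Set where
  fwd : ∀ {u v c} → Fwd w X Y u v c → Edge W w X Y u v c
  bwd : ∀ {u v c} → Fwd w X Y u v c → Edge W w X Y v u (W + 1ℚ)

data Path {Σ' : Set} (W : ℚ) (w : Maybe Σ' → Maybe Σ' → ℚ) {m n : ℕ}
          (X : Vec Σ' m) (Y : Vec Σ' n) : Vertex → Vertex → ℚ → Set where
  here : ∀ {u} → Path W w X Y u u 0ℚ
  step : ∀ {u v z c d} → Edge W w X Y u v c → Path W w X Y v z d →
         Path W w X Y u z (c + d)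

IsDist : {Σ' : Set} (W : ℚ) (w : Maybe Σ' → Maybe Σ' → ℚ) {m n : ℕ}
         (X : Vec Σ' m) (Y : Vec Σ' n) → Vertex → Vertex → ℚ → Set
IsDist W w X Y u v d =
  Path W w X Y u v d × (∀ c → Path W w X Y u v c → d ≤ c)

Matrix : ℕ → ℕ → Set
Matrix p q = Fin p → Fin q → ℚ

_≈⟨_⟩_ : ℚ → ℚ → ℚ → Set
a ≈⟨ k ⟩ b = a ≡ b ⊎ (k ≤ a × k ≤ b)

IsFern : {Σ' : Set} (W : ℚ) (w : Maybe Σ' → Maybe Σ' → ℚ) {m n : ℕ}
         (P : Vec Σ' m) (T : Vec Σ' n) (Δ ∇ : ℕ) (k : ℚ) →
         Matrix (suc Δ) (suc ∇) → Set
IsFern W w {m} {n} P T Δ ∇ k F =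
  ∀ (i : Fin (suc Δ)) (j : Fin (suc ∇)) →
    Σ ℚ λ d → IsDist W w P T (0 , toℕ i) (m , (n ∸ ∇) ℕ.+ toℕ j) d
              × (F i j ≈⟨ k ⟩ d)

private
  rowBound : ∀ {Δ' Δ} → Δ' ℕ.≤ Δ → (i : Fin (suc Δ')) → toℕ i ℕ.< suc Δ
  rowBound p i = s≤s (ℕP.≤-trans (toℕ≤pred[n] i) p)

  colBound : ∀ {∇' ∇} → ∇' ℕ.≤ ∇ → (j : Fin (suc ∇')) →
             (∇ ∸ ∇') ℕ.+ toℕ j ℕ.< suc ∇
  colBound {∇'} {∇} q j = s≤s (ℕP.≤-trans (ℕP.+-monoʳ-≤ (∇ ∸ ∇') (toℕ≤pred[n] j))
                                          (ℕP.≤-reflexive (ℕP.m∸n+n≡m q)))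

subMatrix : ∀ {Δ' Δ ∇' ∇} → Δ' ℕ.≤ Δ → ∇' ℕ.≤ ∇ →
            Matrix (suc Δ) (suc ∇) → Matrix (suc Δ') (suc ∇')
subMatrix {∇' = ∇'} {∇} p q F i j =
  F (fromℕ< (rowBound p i)) (fromℕ< (colBound {∇'} {∇} q j))

density : ∀ {p q} → Matrix (suc p) (suc q) → Matrix p q
density A i j = A (inject₁ i) (fsuc j) + A (fsuc i) (inject₁ j)
                - A (inject₁ i) (inject₁ j) - A (fsuc i) (fsuc j)

δ : ∀ {p q} → Matrix (suc p) (suc q) → ℕ
δ {p} {q} A = length (filter (λ ij → ¬? (density A (proj₁ ij) (proj₂ ij) ≟ 0ℚ))
                             (cartesianProduct (allFin p) (allFin q)))

IntegerValued : ∀ {p q} → Matrix p q → Set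
IntegerValued A = ∀ i j → Σ ℤ λ z → A i j ≡ z / 1

BoundedDifference : ∀ {p q} → ℕ → Matrix (suc p) (suc q) → Set
BoundedDifference {p} {q} β A =
  (∀ (i : Fin (suc p)) (j : Fin q) →
     ∣ A i (inject₁ j) - A i (fsuc j) ∣ ≤ (+ β) / 1)
  × (∀ (i : Fin p) (j : Fin (suc q)) →
     ∣ A (inject₁ i) j - A (fsuc i) j ∣ ≤ (+ β) / 1)

-- F' is the window of F at offset (0 , ∇ − ∇'). Its entry (i , j) is the entry
-- (i , ∇ − ∇' + j) of F, a k-approximation of the distance to the vertex
-- (|P| , |T| − ∇ + (∇ − ∇' + j)) = (|P| , |T| − ∇' + j), which is exactly what the
-- (Δ' → ∇') matrix prescribes; lowering k only weakens k-equivalence. Adjacent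
-- entries and density entries of a window are adjacent entries and density
-- entries of F at shifted positions, so difference bounds carry over and the
-- nonzero density entries of F' inject into those of F.
module Submission where

open import Defs
open import Data.Nat using (ℕ; suc)
open import Data.Rational using (ℚ; 0ℚ; _≤_)
open import Data.Vec using (Vec)
open import Data.Maybe using (Maybe)
open import Data.Product using (_×_)
import Data.Nat as ℕ

open import Data.Nat using (zero; z≤n; s≤s; s≤s⁻¹; _+_; _∸_)
open import Data.Nat.Properties as ℕP
  using (+-0-monoid; +-suc; +-monoʳ-<; +-mono-≤; m≤n+m; m∸n+n≡m; +-∸-assoc; +-assoc)
import Data.Rational.Properties as ℚP
import Data.Integer as ℤ
open import Data.Rational using (_-_; ∣_∣; _/_)
open import Data.Fin using (Fin; toℕ; fromℕ<; inject₁) renaming (zero to fzero; suc to fsuc)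
open import Data.Fin.Properties using (toℕ<n; toℕ-fromℕ<; toℕ-inject₁; toℕ-injective)
open import Data.List using (length; filter; map; tabulate; cartesianProduct; _++_)
open import Data.List.Properties using (filter-++; length-++; map-tabulate)
open import Data.Product using (_,_; proj₁; proj₂)
open import Data.Sum using (inj₁; inj₂)
open import Data.Bool using (true; false; if_then_else_)
open import Function using (id; _∘_)
open import Relation.Nullary using (Dec; does; ¬?)
open import Relation.Unary using (Decidable)
open import Relation.Binary.PropositionalEquality
  using (_≡_; refl; sym; trans; cong; cong₂; subst₂; module ≡-Reasoning)
open import Algebra.Properties.Monoid.Sum +-0-monoid using (sum; sum-syntax; sum-cong-≗)

≈⟨⟩-weaken : ∀ {k' k a b} → k' ≤ k → a ≈⟨ k ⟩ b → a ≈⟨ k' ⟩ b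
≈⟨⟩-weaken k'≤k (inj₁ a≡b)        = inj₁ a≡b
≈⟨⟩-weaken k'≤k (inj₂ (k≤a , k≤b)) = inj₂ (ℚP.≤-trans k'≤k k≤a , ℚP.≤-trans k'≤k k≤b)

IsFern-weaken : ∀ {Σ' : Set} {W} {w : Maybe Σ' → Maybe Σ' → ℚ} {m n}
                {P : Vec Σ' m} {T : Vec Σ' n} {Δ ∇ k' k F} →
                k' ≤ k → IsFern W w P T Δ ∇ k F → IsFern W w P T Δ ∇ k' F
IsFern-weaken k'≤k fern i j =
  let d , dist , Fij≈d = fern i j in d , dist , ≈⟨⟩-weaken k'≤k Fij≈d

m+1+n≤1+o⇒m+n≤o : ∀ m {n o} → m + suc n ℕ.≤ suc o → m + n ℕ.≤ o
m+1+n≤1+o⇒m+n≤o m {n} le = s≤s⁻¹ (ℕP.≤-trans (ℕP.≤-reflexive (sym (+-suc m n))) le)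

m∸n+1+n≡1+m : ∀ {m n} → n ℕ.≤ m → (m ∸ n) + suc n ≡ suc m
m∸n+1+n≡1+m {m} {n} n≤m = trans (+-suc (m ∸ n) n) (cong suc (m∸n+n≡m n≤m))

m∸n+n∸o≡m∸o : ∀ {m n o} → o ℕ.≤ n → n ℕ.≤ m → (m ∸ n) + (n ∸ o) ≡ m ∸ o
m∸n+n∸o≡m∸o {m} {n} {o} o≤n n≤m = begin
  (m ∸ n) + (n ∸ o)    ≡⟨ +-∸-assoc (m ∸ n) o≤n ⟨
  ((m ∸ n) + n) ∸ o    ≡⟨ cong (_∸ o) (m∸n+n≡m n≤m) ⟩
  m ∸ o                ∎
  where open ≡-Reasoning

shift : ∀ {b a} (c : ℕ) → .(c + b ℕ.≤ a) → Fin b → Fin a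
shift c c+b≤a j = fromℕ< (ℕP.≤-trans (+-monoʳ-< c (toℕ<n j)) c+b≤a)

toℕ-shift : ∀ {b a} c .(h : c + b ℕ.≤ a) (j : Fin b) → toℕ (shift c h j) ≡ c + toℕ j
toℕ-shift c h j = toℕ-fromℕ< _

module _ {b a} (c : ℕ) .(h : c + suc b ℕ.≤ suc a) .(h' : c + b ℕ.≤ a) (j : Fin b) where
  open ≡-Reasoning

  shift-inject₁ : shift c h (inject₁ j) ≡ inject₁ (shift c h' j)
  shift-inject₁ = toℕ-injective (begin
    toℕ (shift c h (inject₁ j))  ≡⟨ toℕ-shift c h (inject₁ j) ⟩
    c + toℕ (inject₁ j)          ≡⟨ cong (c +_) (toℕ-inject₁ j) ⟩
    c + toℕ j                    ≡⟨ toℕ-shift c h' j ⟨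
    toℕ (shift c h' j)           ≡⟨ toℕ-inject₁ (shift c h' j) ⟨
    toℕ (inject₁ (shift c h' j)) ∎)

  shift-suc : shift c h (fsuc j) ≡ fsuc (shift c h' j)
  shift-suc = toℕ-injective (begin
    toℕ (shift c h (fsuc j))  ≡⟨ toℕ-shift c h (fsuc j) ⟩
    c + suc (toℕ j)           ≡⟨ +-suc c (toℕ j) ⟩
    suc (c + toℕ j)           ≡⟨ cong suc (toℕ-shift c h' j) ⟨
    suc (toℕ (shift c h' j))  ∎)

∑-mono-≤ : ∀ {n} {f g : Fin n → ℕ} → (∀ i → f i ℕ.≤ g i) → sum f ℕ.≤ sum g
∑-mono-≤ {zero}  f≤g = z≤n
∑-mono-≤ {suc n} f≤g = +-mono-≤ (f≤g fzero) (∑-mono-≤ (f≤g ∘ fsuc))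

-- fromℕ< computes on its index, so shift 0 h ∘ fsuc and shift (suc c) h both
-- reduce to fsuc ∘ shift c h′ and the recursion needs no rewriting.
∑-shift-≤ : ∀ {b a} c (h : c + b ℕ.≤ a) (f : Fin a → ℕ) → sum (f ∘ shift c h) ℕ.≤ sum f
∑-shift-≤ {zero}  c       h       f = z≤n
∑-shift-≤ {suc b} zero    (s≤s h) f = ℕP.+-monoʳ-≤ (f fzero) (∑-shift-≤ 0 h (f ∘ fsuc))
∑-shift-≤ {suc b} (suc c) (s≤s h) f =
  ℕP.≤-trans (∑-shift-≤ c h (f ∘ fsuc)) (m≤n+m _ (f fzero))

indicator : ∀ {p} {A : Set p} → Dec A → ℕ
indicator A? = if does A? then 1 else 0

module _ {p} {A : Set} {P : A → Set p} (P? : Decidable P) where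

  length-filter-tabulate : ∀ {n} (f : Fin n → A) →
                           length (filter P? (tabulate f)) ≡ ∑[ i < n ] indicator (P? (f i))
  length-filter-tabulate {zero}  f = refl
  length-filter-tabulate {suc n} f with does (P? (f fzero))
  ... | true  = cong suc (length-filter-tabulate (f ∘ fsuc))
  ... | false = length-filter-tabulate (f ∘ fsuc)

module _ {p} {A B : Set} {P : A × B → Set p} (P? : Decidable P) where
  open ≡-Reasoning

  length-filter-cartesianProduct :
    ∀ {a b} (f : Fin a → A) (g : Fin b → B) →
    length (filter P? (cartesianProduct (tabulate f) (tabulate g)))
      ≡ ∑[ i < a ] ∑[ j < b ] indicator (P? (f i , g j))
  length-filter-cartesianProduct {zero}  f g = refl
  length-filter-cartesianProduct {suc a} f g = begin
    length (filter P? (firstRow ++ rest))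
      ≡⟨ cong length (filter-++ P? firstRow rest) ⟩
    length (filter P? firstRow ++ filter P? rest)
      ≡⟨ length-++ (filter P? firstRow) ⟩
    length (filter P? firstRow) + length (filter P? rest)
      ≡⟨ cong₂ _+_ (trans (cong (length ∘ filter P?) (map-tabulate g (f fzero ,_)))
                          (length-filter-tabulate P? (λ j → f fzero , g j)))
                   (length-filter-cartesianProduct (f ∘ fsuc) g) ⟩
    ∑[ i < suc a ] ∑[ j < _ ] indicator (P? (f i , g j)) ∎
    where
    firstRow = map (f fzero ,_) (tabulate g)
    rest     = cartesianProduct (tabulate (f ∘ fsuc)) (tabulate g)

isNonzero : ℚ → ℕ
isNonzero x = indicator (¬? (x ℚP.≟ 0ℚ))

nonzeros : ∀ {a b} → Matrix a b → ℕ
nonzeros {a} {b} M = ∑[ i < a ] ∑[ j < b ] isNonzero (M i j)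

nonzeros-cong : ∀ {a b} {M N : Matrix a b} → (∀ i j → M i j ≡ N i j) → nonzeros M ≡ nonzeros N
nonzeros-cong M≡N =
  sum-cong-≗ (λ i → sum-cong-≗ (λ j → cong isNonzero (M≡N i j)))

δ≡nonzeros∘density : ∀ {p q} (A : Matrix (suc p) (suc q)) → δ A ≡ nonzeros (density A)
δ≡nonzeros∘density A =
  length-filter-cartesianProduct (λ ij → ¬? (density A (proj₁ ij) (proj₂ ij) ℚP.≟ 0ℚ)) id id

window : ∀ {a b a' b'} (r c : ℕ) → .(r + a' ℕ.≤ a) → .(c + b' ℕ.≤ b) →
         Matrix a b → Matrix a' b'
window r c hr hc M i j = M (shift r hr i) (shift c hc j)

nonzeros-window-≤ : ∀ {a b a' b'} r c (hr : r + a' ℕ.≤ a) (hc : c + b' ℕ.≤ b) (M : Matrix a b) →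
                    nonzeros (window r c hr hc M) ℕ.≤ nonzeros M
nonzeros-window-≤ r c hr hc M =
  ℕP.≤-trans (∑-mono-≤ (λ i → ∑-shift-≤ c hc (isNonzero ∘ M (shift r hr i))))
             (∑-shift-≤ r hr (λ i → sum (isNonzero ∘ M i)))

module _ {a b a' b'} (r c : ℕ) (hr : r + suc a' ℕ.≤ suc a) (hc : c + suc b' ℕ.≤ suc b) where

  private
    hr' = m+1+n≤1+o⇒m+n≤o r hr
    hc' = m+1+n≤1+o⇒m+n≤o c hc

  density-window : (F : Matrix (suc a) (suc b)) (i : Fin a') (j : Fin b') →
                   density (window r c hr hc F) i j ≡ window r c hr' hc' (density F) i j
  density-window F i j
    rewrite shift-inject₁ r hr hr' i | shift-suc r hr hr' i
          | shift-inject₁ c hc hc' j | shift-suc c hc hc' j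
    = refl

  δ-window-≤ : (F : Matrix (suc a) (suc b)) → δ (window r c hr hc F) ℕ.≤ δ F
  δ-window-≤ F = begin
    δ (window r c hr hc F)                    ≡⟨ δ≡nonzeros∘density (window r c hr hc F) ⟩
    nonzeros (density (window r c hr hc F))   ≡⟨ nonzeros-cong (density-window F) ⟩
    nonzeros (window r c hr' hc' (density F)) ≤⟨ nonzeros-window-≤ r c hr' hc' (density F) ⟩
    nonzeros (density F)                      ≡⟨ δ≡nonzeros∘density F ⟨
    δ F                                       ∎
    where open ℕP.≤-Reasoning

  BoundedDifference-window : ∀ {β} (F : Matrix (suc a) (suc b)) →
                             BoundedDifference β F → BoundedDifference β (window r c hr hc F)
  BoundedDifference-window {β} F (horizontal , vertical) = horizontal′ , vertical′
    where
    bound = ℤ.+ β / 1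
    horizontal′ : ∀ i j → ∣ window r c hr hc F i (inject₁ j) - window r c hr hc F i (fsuc j) ∣ ≤ bound
    horizontal′ i j rewrite shift-inject₁ c hc hc' j | shift-suc c hc hc' j =
      horizontal (shift r hr i) (shift c hc' j)
    vertical′ : ∀ i j → ∣ window r c hr hc F (inject₁ i) j - window r c hr hc F (fsuc i) j ∣ ≤ bound
    vertical′ i j rewrite shift-inject₁ r hr hr' i | shift-suc r hr hr' i =
      vertical (shift r hr' i) (shift c hc j)

IsFern-subMatrix : ∀ {Σ' : Set} {W} {w : Maybe Σ' → Maybe Σ' → ℚ} {m n}
                   {P : Vec Σ' m} {T : Vec Σ' n} {Δ' Δ ∇' ∇ k F} →
                   ∇ ℕ.≤ n → (p : Δ' ℕ.≤ Δ) (q : ∇' ℕ.≤ ∇) →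
                   IsFern W w P T Δ ∇ k F → IsFern W w P T Δ' ∇' k (subMatrix p q F)
IsFern-subMatrix {W = W} {w} {m} {n} {P} {T} {∇' = ∇'} {∇} ∇≤n p q fern i j =
  let d , dist , Fij≈d = fern (shift 0 rows i) (shift (∇ ∸ ∇') columns j) in
  d , subst₂ (λ x y → IsDist W w P T (0 , x) (m , y) d) (toℕ-shift 0 rows i) column dist , Fij≈d
  where
  rows    = s≤s p
  columns = ℕP.≤-reflexive (m∸n+1+n≡1+m q)
  open ≡-Reasoning
  column : (n ∸ ∇) + toℕ (shift (∇ ∸ ∇') columns j) ≡ (n ∸ ∇') + toℕ j
  column = begin
    (n ∸ ∇) + toℕ (shift (∇ ∸ ∇') columns j) ≡⟨ cong ((n ∸ ∇) +_) (toℕ-shift (∇ ∸ ∇') columns j) ⟩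
    (n ∸ ∇) + ((∇ ∸ ∇') + toℕ j)             ≡⟨ +-assoc (n ∸ ∇) (∇ ∸ ∇') (toℕ j) ⟨
    ((n ∸ ∇) + (∇ ∸ ∇')) + toℕ j             ≡⟨ cong (_+ toℕ j) (m∸n+n∸o≡m∸o q ∇≤n) ⟩
    (n ∸ ∇') + toℕ j                         ∎

lemma5p20 : {Σ' : Set} (W : ℚ) (w : Maybe Σ' → Maybe Σ' → ℚ) → Normalized W w →
    {m n : ℕ} (P : Vec Σ' m) (T : Vec Σ' n) →
    (Δ' Δ ∇' ∇ : ℕ) → Δ ℕ.≤ n → ∇ ℕ.≤ n →
    (p : Δ' ℕ.≤ Δ) (q : ∇' ℕ.≤ ∇) →
    (k' k : ℚ) → 0ℚ ≤ k' → k' ≤ k →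
    (F : Matrix (suc Δ) (suc ∇)) → IsFern W w P T Δ ∇ k F →
    IsFern W w P T Δ' ∇' k' (subMatrix p q F)
    × δ (subMatrix p q F) ℕ.≤ δ F
    × (∀ (β : ℕ) → IntegerValued F → BoundedDifference β F →
         IntegerValued (subMatrix p q F) × BoundedDifference β (subMatrix p q F))
lemma5p20 W w _ P T Δ' Δ ∇' ∇ _ ∇≤n p q k' k _ k'≤k F fern =
    IsFern-weaken k'≤k (IsFern-subMatrix ∇≤n p q fern)
  , δ-window-≤ 0 (∇ ∸ ∇') rows columns F
  , λ β integral bounded →
      (λ i j → integral _ _) , BoundedDifference-window 0 (∇ ∸ ∇') rows columns {β} F bounded
  where
  -- subMatrix p q F is definitionally the window of F at offset (0 , ∇ ∸ ∇').
  rows    = s≤s p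
  columns = ℕP.≤-reflexive (m∸n+1+n≡1+m q)
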